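{- The transformation tree of an array $A$ has the max-heap property: the weight of every node is at most the weight of its parent.
   Context: For an array $A[1..n]$ let $S(i,j)=\sum_{k=i}^{j}A[k]$. The transformation tree of $A$ is defined recursively: if $A$ is empty or consists only of negative numbers, it is empty. Otherwise let $[i,j]$ be a maximum-sum segment of $A$ (a range maximizing $S(i,j)$); the root has weight $S(i,j)$ and up to three children: the left child is the transformation tree of $A[1..i-1]$, the middle child is the transformation tree of $-A[i..j]$ (the copy of $A[i..j]$ with all numbers multiplied by $-1$), and the right child is the transformation tree of $A[j+1..n]$; a child is not created if the corresponding range is empty. -}

module Defs where

open import Data.Integer using (ℤ; _≤_; _<_; -_; 0ℤ; _+_)
open import Data.Product using (_×_)
open import Data.List using (List; []; _∷_; _++_; map; foldr)
open import Data.List.Relation.Unary.All using (All)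
open import Data.Unit using (⊤)
open import Relation.Nullary using (¬_)
open import Relation.Binary.PropositionalEquality using (_≡_; _≢_)

-- Array A[1..n] as a list of integers.
-- A segment A[i..j] (i ≤ j) is represented by a decomposition
-- A = A[1..i-1] ++ A[i..j] ++ A[j+1..n] with nonempty middle part.

sum : List ℤ → ℤ
sum = foldr _+_ 0ℤ

AllNegative : List ℤ → Set
AllNegative A = All (λ x → x < 0ℤ) A

IsMaxSegment : List ℤ → List ℤ → List ℤ → List ℤ → Set
IsMaxSegment A P M Q =
  (A ≡ P ++ M ++ Q) × (M ≢ []) ×
  (∀ (P′ M′ Q′ : List ℤ) → A ≡ P′ ++ M′ ++ Q′ → M′ ≢ [] → sum M′ ≤ sum M)

-- ternary trees with integer node weights; `empty` is the empty tree
-- (a non-created child is represented by the empty tree)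
data Tree : Set where
  empty : Tree
  node  : ℤ → Tree → Tree → Tree → Tree

-- TransformationTree A T : T is a transformation tree of A
-- (for some choice of maximum-sum segments at each step).
data TransformationTree : List ℤ → Tree → Set where
  tt-empty : ∀ {A} → AllNegative A → TransformationTree A empty
  tt-node  : ∀ {A P M Q l m r} →
             ¬ AllNegative A →
             IsMaxSegment A P M Q →
             TransformationTree P l →
             TransformationTree (map -_ M) m →
             TransformationTree Q r →
             TransformationTree A (node (sum M) l m r)

RootAtMost : ℤ → Tree → Set
RootAtMost w empty          = ⊤
RootAtMost w (node v _ _ _) = v ≤ w

data MaxHeap : Tree → Set where
  heap-empty : MaxHeap empty
  heap-node  : ∀ {w l m r} →
               RootAtMost w l → RootAtMost w m → RootAtMost w r →
               MaxHeap l → MaxHeap m → MaxHeap r →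
               MaxHeap (node w l m r)

-- Every node of the tree is the sum of a nonempty segment of the array it was built from,
-- and that array is P, Q or −M for the parent's maximum-sum segment M of A = P ++ M ++ Q.
-- Segments of P and Q are segments of A, so their sums are bounded by sum M by maximality.
-- A segment of −M has sum −s where M = a ++ s ++ b; maximality (and sum M ≥ 0, witnessed by
-- any nonnegative entry) gives sum a ≤ sum M and sum b ≤ sum M, and adding these yields
-- sum M − s ≤ 2 sum M, i.e. −s ≤ sum M.
module Submission where

open import Defs
open import Data.Integer using (ℤ; _+_; -_; 0ℤ; _≤_; _<?_)
open import Data.Integer.Properties
  using (≤-trans; +-mono-≤; +-monoˡ-≤; +-identityˡ; +-identityʳ;
         module ≤-Reasoning; +-assoc; neg-distrib-+; neg-involutive; ≮⇒≥)
open import Data.Integer.Tactic.RingSolver using (solve)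
open import Data.List using (List; []; _∷_; _++_; map; [_])
open import Data.List.Properties using (++-assoc; ++-identityʳ; map-++)
open import Data.List.Membership.Propositional using (find)
open import Data.List.Membership.Propositional.Properties using (∈-∃++)
open import Data.List.Relation.Unary.All.Properties.Core using (¬All⇒Any¬)
open import Data.Product using (_,_)
open import Data.Unit using (tt)
open import Relation.Nullary using (¬_)
open import Relation.Binary.PropositionalEquality
  using (_≡_; _≢_; refl; sym; trans; cong; cong₂; subst; module ≡-Reasoning)

sum-++ : ∀ xs ys → sum (xs ++ ys) ≡ sum xs + sum ys
sum-++ []       ys = sym (+-identityˡ (sum ys))
sum-++ (x ∷ xs) ys = trans (cong (x +_) (sum-++ xs ys)) (sym (+-assoc x (sum xs) (sum ys)))

sum-map-neg : ∀ xs → sum (map -_ xs) ≡ - sum xs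
sum-map-neg []       = refl
sum-map-neg (x ∷ xs) = trans (cong (- x +_) (sum-map-neg xs)) (sym (neg-distrib-+ x (sum xs)))

map-neg-involutive : ∀ xs → map -_ (map -_ xs) ≡ xs
map-neg-involutive []       = refl
map-neg-involutive (x ∷ xs) = cong₂ _∷_ (neg-involutive x) (map-neg-involutive xs)

-s≤a+[s+b] : ∀ a s b → a ≤ a + (s + b) → b ≤ a + (s + b) → - s ≤ a + (s + b)
-s≤a+[s+b] a s b a≤t b≤t = begin
  - s                                             ≡⟨ solve (a ∷ s ∷ b ∷ []) ⟩
  (a + b) + - (a + (s + b))                       ≤⟨ +-monoˡ-≤ _ (+-mono-≤ a≤t b≤t) ⟩
  (a + (s + b) + (a + (s + b))) + - (a + (s + b)) ≡⟨ solve (a ∷ s ∷ b ∷ []) ⟩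
  a + (s + b)                                     ∎
  where open ≤-Reasoning

SegmentSumsAtMost : ℤ → List ℤ → Set
SegmentSumsAtMost w A = ∀ P M Q → A ≡ P ++ M ++ Q → M ≢ [] → sum M ≤ w

segmentSumsAtMost-++ˡ : ∀ {w} xs ys → SegmentSumsAtMost w (xs ++ ys) → SegmentSumsAtMost w xs
segmentSumsAtMost-++ˡ xs ys bound P M Q xs≡PMQ = bound P M (Q ++ ys) (begin
  xs ++ ys             ≡⟨ cong (_++ ys) xs≡PMQ ⟩
  (P ++ M ++ Q) ++ ys  ≡⟨ ++-assoc P (M ++ Q) ys ⟩
  P ++ (M ++ Q) ++ ys  ≡⟨ cong (P ++_) (++-assoc M Q ys) ⟩
  P ++ M ++ Q ++ ys    ∎)
  where open ≡-Reasoning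

segmentSumsAtMost-++ʳ : ∀ {w} xs ys → SegmentSumsAtMost w (xs ++ ys) → SegmentSumsAtMost w ys
segmentSumsAtMost-++ʳ xs ys bound P M Q ys≡PMQ =
  bound (xs ++ P) M Q (trans (cong (xs ++_) ys≡PMQ) (sym (++-assoc xs P (M ++ Q))))

root-≤ : ∀ {w A t} → SegmentSumsAtMost w A → TransformationTree A t → RootAtMost w t
root-≤ bound (tt-empty _) = tt
root-≤ bound (tt-node {P = P} {M} {Q} _ (A≡PMQ , M≢[] , _) _ _ _) = bound P M Q A≡PMQ M≢[]

prefix-sum-≤ : ∀ {w} xs ys → 0ℤ ≤ w → SegmentSumsAtMost w (xs ++ ys) → sum xs ≤ w
prefix-sum-≤ []       ys 0≤w bound = 0≤w
prefix-sum-≤ (x ∷ xs) ys 0≤w bound = bound [] (x ∷ xs) ys refl λ ()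

suffix-sum-≤ : ∀ {w} xs ys → 0ℤ ≤ w → SegmentSumsAtMost w (xs ++ ys) → sum ys ≤ w
suffix-sum-≤ xs []       0≤w bound = 0≤w
suffix-sum-≤ xs (y ∷ ys) 0≤w bound =
  bound xs (y ∷ ys) [] (cong (xs ++_) (sym (++-identityʳ (y ∷ ys)))) λ ()

infix-neg-sum-≤ : ∀ {M} a s b → M ≡ a ++ s ++ b →
                  0ℤ ≤ sum M → SegmentSumsAtMost (sum M) M → - sum s ≤ sum M
infix-neg-sum-≤ a s b refl 0≤sum bound =
  subst (- sum s ≤_) (sym sum≡) (-s≤a+[s+b] (sum a) (sum s) (sum b)
    (subst (sum a ≤_) sum≡ (prefix-sum-≤ a (s ++ b) 0≤sum bound))
    (subst (sum b ≤_) sum≡ (suffix-sum-≤ s b 0≤sum (segmentSumsAtMost-++ʳ a (s ++ b) bound))))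
  where
  sum≡ : sum (a ++ s ++ b) ≡ sum a + (sum s + sum b)
  sum≡ = trans (sum-++ a (s ++ b)) (cong (sum a +_) (sum-++ s b))

neg-segmentSumsAtMost : ∀ M → 0ℤ ≤ sum M → SegmentSumsAtMost (sum M) M →
                        SegmentSumsAtMost (sum M) (map -_ M)
neg-segmentSumsAtMost M 0≤sum bound P M′ Q −M≡PM′Q _ =
  subst (_≤ sum M) sum[−−M′]≡sumM′
    (infix-neg-sum-≤ (map -_ P) (map -_ M′) (map -_ Q) M≡−P−M′−Q 0≤sum bound)
  where
  sum[−−M′]≡sumM′ : - sum (map -_ M′) ≡ sum M′
  sum[−−M′]≡sumM′ = trans (sym (sum-map-neg (map -_ M′))) (cong sum (map-neg-involutive M′))
  M≡−P−M′−Q : M ≡ map -_ P ++ map -_ M′ ++ map -_ Q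
  M≡−P−M′−Q = begin
    M                                  ≡⟨ map-neg-involutive M ⟨
    map -_ (map -_ M)                  ≡⟨ cong (map -_) −M≡PM′Q ⟩
    map -_ (P ++ M′ ++ Q)              ≡⟨ map-++ -_ P (M′ ++ Q) ⟩
    map -_ P ++ map -_ (M′ ++ Q)       ≡⟨ cong (map -_ P ++_) (map-++ -_ M′ Q) ⟩
    map -_ P ++ map -_ M′ ++ map -_ Q  ∎
    where open ≡-Reasoning

maxSegment-segmentSumsAtMost : ∀ {A P M Q} → IsMaxSegment A P M Q →
                               SegmentSumsAtMost (sum M) (P ++ M ++ Q)
maxSegment-segmentSumsAtMost {M = M} (A≡PMQ , _ , maximal) =
  subst (SegmentSumsAtMost (sum M)) A≡PMQ maximal

maxSegment-0≤sum : ∀ {A P M Q} → ¬ AllNegative A → IsMaxSegment A P M Q → 0ℤ ≤ sum M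
maxSegment-0≤sum {A} {M = M} ¬neg (_ , _ , maximal)
  with x , x∈A , x≮0 ← find (¬All⇒Any¬ (_<? 0ℤ) A ¬neg)
  with P′ , Q′ , A≡P′xQ′ ← ∈-∃++ x∈A
  = ≤-trans (≮⇒≥ x≮0) (subst (_≤ sum M) (+-identityʳ x) (maximal P′ [ x ] Q′ A≡P′xQ′ λ ()))

lemma12 : (A : List ℤ) (T : Tree) → TransformationTree A T → MaxHeap T
lemma12 _ _ (tt-empty _) = heap-empty
lemma12 _ _ (tt-node {P = P} {M} {Q} ¬neg seg tl tm tr) = heap-node
  (root-≤ (segmentSumsAtMost-++ˡ P (M ++ Q) bound) tl)
  (root-≤ (neg-segmentSumsAtMost M (maxSegment-0≤sum {P = P} {Q = Q} ¬neg seg) boundM) tm)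
  (root-≤ (segmentSumsAtMost-++ʳ M Q boundMQ) tr)
  (lemma12 _ _ tl) (lemma12 _ _ tm) (lemma12 _ _ tr)
  where
  bound : SegmentSumsAtMost (sum M) (P ++ M ++ Q)
  bound = maxSegment-segmentSumsAtMost {P = P} {Q = Q} seg
  boundMQ : SegmentSumsAtMost (sum M) (M ++ Q)
  boundMQ = segmentSumsAtMost-++ʳ P (M ++ Q) bound
  boundM : SegmentSumsAtMost (sum M) M
  boundM = segmentSumsAtMost-++ˡ M Q boundMQ
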